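{- Let $J'\subseteq J$, $t_o\in[0,T-\sum_{j\in J'}p_j]$, and let $\alpha$, $c_1<\dots<c_m$, $M$ and $B_\alpha$ be as in the context. Let $q\in\{1,\dots,m-1\}$ and let $t_\alpha\in[c_q,c_{q+1})$ with $t_\alpha\in[t_o,t_e-p_\alpha]$ and $t_\alpha\notin B_\alpha$. Let $j,k\in J'\setminus\{\alpha\}$ with $M(j)\le q<M(k)$. Then for any schedule of $J'$ starting at $t_o$ in which $\alpha$ starts at time $t_\alpha$, job $j$ is processed before $\alpha$ and job $k$ is processed after $\alpha$ (regardless of the start times of $j$ and $k$), none of the relations imposed by the dominance rule on the pairs $\{\alpha,j\}$, $\{\alpha,k\}$, $\{j,k\}$ is violated.
   Context: $J$ is a finite set of jobs; job $j$ has processing time $p_j>0$ and weight $w_j>0$; $T=\sum_{j\in J}p_j$. A schedule of $J'\subseteq J$ starting at time $t_o\ge0$ processes the jobs of $J'$ in some order consecutively without idle time from $t_o$; $t_j$ is the (absolute) start time of $j$. For $t\ge0$, $\varphi_j(t)=\frac{w_j}{p_j(p_j+t)}$. For distinct jobs $i,j$ with $w_ip_j\neq w_jp_i$, $t^*_{ij}=t^*_{ji}=\frac{w_jp_i^2-w_ip_j^2}{w_ip_j-w_jp_i}$, the unique real $t$ with $\varphi_i(t)=\varphi_j(t)$. Dominance rule. For distinct jobs $i,j$: (a) if $\varphi_i(t)\ge\varphi_j(t)$ for all $t\ge0$ and $\varphi_i\not\equiv\varphi_j$, the rule imposes "$i\prec_g j$", which a schedule violates if $j$ is processed before $i$; (b)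 if neither $\varphi_i\ge\varphi_j$ nor $\varphi_j\ge\varphi_i$ holds on all of $[0,\infty)$, then $t^*_{ij}>0$, and naming the jobs so that $\varphi_i(0)>\varphi_j(0)$, the rule imposes "$i\prec_{g[0,t^*_{ij})}j$", violated if $j$ is processed before $i$ and $t_i-p_j<t^*_{ij}$, and "$j\prec_{g[t^*_{ij},\infty)}i$", violated if $i$ is processed before $j$ and $t_i\ge t^*_{ij}$. Subproblem data. Let $t_e=t_o+\sum_{j\in J'}p_j$. Let $\alpha\in J'$ maximize $\varphi_i(t_o)$ over $i\in J'$, ties broken by choosing among the maximizers one with maximum $\varphi(t_e)$. Let $C=\{t^*_{\alpha j}+p_j : j\in J'\setminus\{\alpha\},\ t^*_{\alpha j}\text{ defined},\ t^*_{\alpha j}+p_j\in(t_o,t_e)\}\cup\{t_o,t_e\}$ with distinct elements $c_1<\dots<c_m$. Define $M(\alpha)=1$; for $j\neq\alpha$, if $t^*_{\alpha j}$ is defined, $t^*_{\alpha j}\in(t_o,t_e)$ and $t^*_{\alpha j}+p_j<t_e$, let $M(j)$ be the index $q$ with $c_q=t^*_{\alpha j}+p_j$; otherwise $M(j)=|J'|+1$. Let $B_\alpha=\bigcup [t^*_{\alpha j},t^*_{\alpha j}+p_j)$ over all $j\in J\setminus\{\alpha\}$ with $\varphi_\alpha(0)>\varphi_j(0)$ and $t^*_{\alpha j}\in(0,T)$.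
   Formalization: The processing times $p_j$, weights $w_j$ and times $t_o$, $t_\alpha$ are rational, and the comparisons of $\varphi_i$ with $\varphi_j$ on $[0,\infty)$ range over rational t only. -}

module Defs where

open import Data.Nat using (ℕ; suc)
open import Data.Fin using (Fin)
open import Data.Fin.Properties using () renaming (_≟_ to _≟ᶠ_)
open import Data.Fin.Subset using (Subset; _∈_; ∣_∣)
open import Data.Fin.Subset.Properties using (_∈?_)
open import Data.Rational using (ℚ; 0ℚ; _+_; _-_; _*_; _÷_; _≤_; _<_; ≢-nonZero)
open import Data.Rational.Properties using (_≟_)
open import Data.List using (List; []; _∷_; _++_; filter; map; foldr; allFin)
open import Data.List.Relation.Unary.Unique.Propositional using (Unique)
import Data.List.Membership.Propositional as LM
open import Data.Maybe using (Maybe; just; nothing)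
open import Data.Product using (Σ; ∃; _×_; _,_)
open import Data.Sum using (_⊎_)
open import Relation.Nullary using (¬_; yes; no)
open import Relation.Binary.PropositionalEquality using (_≡_; _≢_)
open import Function.Bundles using (_⇔_)

sumℚ : List ℚ → ℚ
sumℚ = foldr _+_ 0ℚ

-- Total division: x ÷ y for y ≠ 0 (only ever used with y ≠ 0; value 0 otherwise).
_÷₀_ : ℚ → ℚ → ℚ
x ÷₀ y with y ≟ 0ℚ
... | yes _ = 0ℚ
... | no y≢0 = _÷_ x y {{≢-nonZero y≢0}}

record Instance (n : ℕ) : Set where
  field
    p     : Fin n → ℚ
    w     : Fin n → ℚ
    p-pos : ∀ j → 0ℚ < p j
    w-pos : ∀ j → 0ℚ < w j

module _ {n : ℕ} (I : Instance n) where
  open Instance I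

  T : ℚ
  T = sumℚ (map p (allFin n))

  sumP : Subset n → ℚ
  sumP J' = sumℚ (map p (filter (_∈? J') (allFin n)))

  -- φ_j(t) = w_j / (p_j (p_j + t))   (used for t ≥ 0, where the denominator is > 0)
  φ : Fin n → ℚ → ℚ
  φ j t = w j ÷₀ (p j * (p j + t))

  tstar : Fin n → Fin n → Maybe ℚ
  tstar i j with (w i * p j) ≟ (w j * p i)
  ... | yes _ = nothing
  ... | no _  = just (((w j * p i) * p i - (w i * p j) * p j) ÷₀ (w i * p j - w j * p i))

  IsScheduleOf : Subset n → List (Fin n) → Set
  IsScheduleOf J' σ = Unique σ × (∀ i → (i ∈ J') ⇔ (i LM.∈ σ))

  startAt : ℚ → List (Fin n) → Fin n → ℚ
  startAt t [] j = t
  startAt t (x ∷ σ) j with x ≟ᶠ j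
  ... | yes _ = t
  ... | no _  = startAt (t + p x) σ j

  Before : List (Fin n) → Fin n → Fin n → Set
  Before σ i j = ∃ λ xs → ∃ λ ys → ∃ λ zs → σ ≡ xs ++ (i ∷ ys) ++ (j ∷ zs)

  Dom : Fin n → Fin n → Set
  Dom i j = ∀ t → 0ℚ ≤ t → φ j t ≤ φ i t

  SameФ : Fin n → Fin n → Set
  SameФ i j = ∀ t → 0ℚ ≤ t → φ i t ≡ φ j t

  -- The dominance rule relations, with i as the job named first, are violated
  -- by schedule σ started at t0.
  --  (a) rule i ≺_g j  violated: j before i;
  --  (b) with φ_i(0) > φ_j(0): rule i ≺_{g[0,t*)} j violated: j before i and t_i - p_j < t*;
  --      rule j ≺_{g[t*,∞)} i violated: i before j and t_i ≥ t*.
  ViolatedNamed : ℚ → List (Fin n) → Fin n → Fin n → Set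
  ViolatedNamed t0 σ i j =
      (Dom i j × ¬ SameФ i j × Before σ j i)
    ⊎ (¬ Dom i j × ¬ Dom j i × φ j 0ℚ < φ i 0ℚ ×
        ∃ λ s → tstar i j ≡ just s ×
          ((Before σ j i × startAt t0 σ i - p j < s) ⊎ (Before σ i j × s ≤ startAt t0 σ i)))

  PairViolated : ℚ → List (Fin n) → Fin n → Fin n → Set
  PairViolated t0 σ i j = ViolatedNamed t0 σ i j ⊎ ViolatedNamed t0 σ j i

  tEnd : Subset n → ℚ → ℚ
  tEnd J' to = to + sumP J'

  IsAlpha : Subset n → ℚ → Fin n → Set
  IsAlpha J' to α = α ∈ J' × (∀ i → i ∈ J' → φ i to ≤ φ α to)
    × (∀ i → i ∈ J' → φ i to ≡ φ α to → φ i (tEnd J' to) ≤ φ α (tEnd J' to))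

  InC : Subset n → ℚ → Fin n → ℚ → Set
  InC J' to α x = x ≡ to ⊎ x ≡ tEnd J' to
    ⊎ (∃ λ j → j ∈ J' × j ≢ α × ∃ λ s → tstar α j ≡ just s × x ≡ s + p j
         × to < x × x < tEnd J' to)

  -- c_1 < ... < c_m (1-based, c : ℕ → ℚ, only indices 1..m matter) are the distinct elements of C
  IsSortedC : Subset n → ℚ → Fin n → (m : ℕ) → (ℕ → ℚ) → Set
  IsSortedC J' to α m c =
      (∀ a b → 1 Data.Nat.≤ a → a Data.Nat.< b → b Data.Nat.≤ m → c a < c b)
    × (∀ x → InC J' to α x ⇔ (∃ λ a → 1 Data.Nat.≤ a × a Data.Nat.≤ m × c a ≡ x))

  MCond : Subset n → ℚ → Fin n → Fin n → ℚ → Set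
  MCond J' to α j s = tstar α j ≡ just s × to < s × s < tEnd J' to × s + p j < tEnd J' to

  MIs : Subset n → ℚ → Fin n → (m : ℕ) → (ℕ → ℚ) → Fin n → ℕ → Set
  MIs J' to α m c j q =
      (j ≡ α × q ≡ 1)
    ⊎ (j ≢ α × ∃ λ s → MCond J' to α j s
         × 1 Data.Nat.≤ q × q Data.Nat.≤ m × c q ≡ s + p j)
    ⊎ (j ≢ α × ¬ (∃ λ s → MCond J' to α j s) × q ≡ suc ∣ J' ∣)

  InB : Fin n → ℚ → Set
  InB α t = ∃ λ j → j ≢ α × φ j 0ℚ < φ α 0ℚ × ∃ λ s → tstar α j ≡ just s
    × 0ℚ < s × s < T × s ≤ t × t < s + p j

{-# OPTIONS --safe #-}
module Submission where

-- Write Δ a b t for φ a t − φ b t multiplied by the positive common denominator: it is affine in t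
-- and vanishes at t*_{ab}. Since M(j) ≤ q, the crossing t*_{αj} lies in (t_o, t_α − p_j]; as α beats j
-- at t_o, the slope of Δ α j is negative, so α beats j at 0 while j beats α at t_α (weakly at t_α − p_j).
-- Since M(k) > q and t_α ∉ B_α, no negative-slope crossing t*_{αk} lies at or before t_α, so α stays
-- ahead of k on [t_o, t_α], and j beats k at t_α. Each relation that the order j, α, k could violate
-- contradicts one of these comparisons; the one remaining case, k dominating α although tied with it
-- at t_o and (by the tie-break) at t_e, makes Δ α k vanish twice, hence φ_α ≡ φ_k. M(j) = |J'| + 1 is
-- excluded by counting: every c_a < t_e is t_o or t*_{αx} + p_x for a distinct job x ∈ J'.

open import Defs
open import Data.Nat using (ℕ; zero; suc)
open import Data.Fin using (Fin; toℕ)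
open import Data.Fin.Subset using (Subset; _∈_; ∣_∣)
open import Data.Rational using (ℚ; 0ℚ; _+_; _-_; _≤_; _<_; _*_; -_; NonZero; ≢-nonZero; positive; nonNegative; negative; nonPositive)
open import Data.List using (List; []; _∷_; _++_; length)
open import Data.Product using (∃; _×_; _,_; proj₁; proj₂)
open import Relation.Nullary using (¬_; yes; no)
open import Relation.Binary.PropositionalEquality using (_≡_; _≢_; refl; sym; trans; cong; cong₂; subst; subst₂; module ≡-Reasoning)

import Data.Nat as ℕ
import Data.Nat.Properties as ℕ
import Data.Fin.Subset as Subset
open import Data.Empty using (⊥-elim)
open import Data.Fin.Properties using (toℕ-injective; toℕ<n) renaming (_≟_ to _≟ᶠ_)
open import Data.Fin.Subset.Properties using (x∈p∧x≢y⇒x∈p-y; x∈p⇒∣p-x∣<∣p∣)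
open import Data.List.Properties using (length-tabulate)
open import Data.List.Relation.Unary.All as All using (All; []; _∷_)
open import Data.List.Relation.Unary.All.Properties using (++⁻ʳ) renaming (tabulate⁺ to all-tabulate⁺)
open import Data.List.Relation.Unary.AllPairs using (_∷_)
open import Data.List.Relation.Unary.Unique.Propositional using (Unique)
open import Data.List.Relation.Unary.Unique.Propositional.Properties using () renaming (tabulate⁺ to unique-tabulate⁺)
open import Data.Maybe using (just)
open import Data.Maybe.Properties using (just-injective)
open import Data.Rational.Properties
open import Data.Rational.Solver using (module +-*-Solver)
open import Data.Sum using (_⊎_; inj₁; inj₂)
open import Function using (_∘_)
open import Function.Bundles using (module Equivalence)
open import Relation.Binary.Definitions using (tri<; tri≈; tri>)
open import Relation.Nullary.Negation using (contradiction)
open +-*-Solver using (solve; _:+_; _:-_; _:*_; _:=_; con)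

<⇒≱ : ∀ {x y} → x < y → ¬ (y ≤ x)
<⇒≱ x<y y≤x = <-irrefl refl (<-≤-trans x<y y≤x)

x<x+y : ∀ {x y} → 0ℚ < y → x < x + y
x<x+y {x} {y} 0<y = subst (_< x + y) (+-identityʳ x) (+-monoʳ-< x 0<y)

x-y+y≡x : ∀ x y → x - y + y ≡ x
x-y+y≡x = solve 2 (λ x y → x :- y :+ y := x) refl

x+y-y≡x : ∀ x y → x + y - y ≡ x
x+y-y≡x = solve 2 (λ x y → x :+ y :- y := x) refl

x-y≡0⇒x≡y : ∀ {x y} → x - y ≡ 0ℚ → x ≡ y
x-y≡0⇒x≡y {x} {y} x-y≡0 = begin
  x          ≡⟨ sym (x-y+y≡x x y) ⟩
  x - y + y  ≡⟨ cong (_+ y) x-y≡0 ⟩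
  0ℚ + y     ≡⟨ +-identityˡ y ⟩
  y          ∎
  where open ≡-Reasoning

x≤y⇒0≤y-x : ∀ {x y} → x ≤ y → 0ℚ ≤ y - x
x≤y⇒0≤y-x {x} {y} x≤y = subst (_≤ y - x) (+-inverseʳ x) (+-monoˡ-≤ (- x) x≤y)

x≤y⇒x-y≤0 : ∀ {x y} → x ≤ y → x - y ≤ 0ℚ
x≤y⇒x-y≤0 {x} {y} x≤y = subst (x - y ≤_) (+-inverseʳ y) (+-monoˡ-≤ (- y) x≤y)

0≤y-x⇒x≤y : ∀ {x y} → 0ℚ ≤ y - x → x ≤ y
0≤y-x⇒x≤y {x} {y} 0≤y-x = subst₂ _≤_ (+-identityˡ x) (x-y+y≡x y x) (+-monoˡ-≤ x 0≤y-x)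

x-y≤0⇒x≤y : ∀ {x y} → x - y ≤ 0ℚ → x ≤ y
x-y≤0⇒x≤y {x} {y} x-y≤0 = subst₂ _≤_ (x-y+y≡x x y) (+-identityˡ y) (+-monoˡ-≤ y x-y≤0)

x+z≤y⇒x≤y-z : ∀ {x y z} → x + z ≤ y → x ≤ y - z
x+z≤y⇒x≤y-z {x} {y} {z} x+z≤y = subst (_≤ y - z) (x+y-y≡x x z) (+-monoˡ-≤ (- z) x+z≤y)

x≤y-z⇒x+z≤y : ∀ {x y z} → x ≤ y - z → x + z ≤ y
x≤y-z⇒x+z≤y {x} {y} {z} x≤y-z = subst (x + z ≤_) (x-y+y≡x y z) (+-monoˡ-≤ z x≤y-z)

÷₀-*-cancel : ∀ x {y} → y ≢ 0ℚ → (x ÷₀ y) * y ≡ x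
÷₀-*-cancel x {y} y≢0 with y ≟ 0ℚ
... | yes y≡0 = ⊥-elim (y≢0 y≡0)
... | no y≢0′ = trans (*-assoc x _ y) (trans (cong (x *_) (*-inverseˡ y)) (*-identityʳ x))
  where
  instance
    y-nonZero : NonZero y
    y-nonZero = ≢-nonZero y≢0′

module Crossing {n : ℕ} (I : Instance n) where
  open Instance I

  variable
    a b : Fin n
    s t t′ : ℚ

  X : Fin n → ℚ → ℚ
  X a t = p a * (p a + t)

  slope : Fin n → Fin n → ℚ
  slope a b = w a * p b - w b * p a

  intercept : Fin n → Fin n → ℚ
  intercept a b = w a * p b * p b - w b * p a * p a

  -- Δ a b t = w a X b t − w b X a t is φ a t − φ b t multiplied by the positive X a t X b t.
  Δ : Fin n → Fin n → ℚ → ℚ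
  Δ a b t = slope a b * t + intercept a b

  X-pos : 0ℚ ≤ t → 0ℚ < X a t
  X-pos {t = t} {a = a} 0≤t = positive⁻¹ (X a t)
    {{pos*pos⇒pos (p a) {{positive (p-pos a)}} (p a + t) {{pos+nonNeg⇒pos (p a) {{positive (p-pos a)}} t {{nonNegative 0≤t}}}}}}

  φ*X≡w : 0ℚ ≤ t → φ I a t * X a t ≡ w a
  φ*X≡w {t = t} {a = a} 0≤t = ÷₀-*-cancel (w a) (λ X≡0 → <-irrefl (sym X≡0) (X-pos 0≤t))

  Δ≡[φ-φ]*X*X : 0ℚ ≤ t → Δ a b t ≡ φ I a t * (X a t * X b t) - φ I b t * (X a t * X b t)
  Δ≡[φ-φ]*X*X {t = t} {a = a} {b = b} 0≤t = begin
    Δ a b t                                   ≡⟨ solve 5 (λ wa pa wb pb t →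
        (wa :* pb :- wb :* pa) :* t :+ (wa :* pb :* pb :- wb :* pa :* pa)
          := wa :* (pb :* (pb :+ t)) :- wb :* (pa :* (pa :+ t))) refl (w a) (p a) (w b) (p b) t ⟩
    w a * X b t - w b * X a t                 ≡⟨ cong₂ _-_ (cong (_* X b t) (sym (φ*X≡w 0≤t)))
                                                           (cong (_* X a t) (sym (φ*X≡w 0≤t))) ⟩
    φ I a t * X a t * X b t - φ I b t * X b t * X a t
                                              ≡⟨ solve 4 (λ u v xa xb → u :* xa :* xb :- v :* xb :* xa
                                                   := u :* (xa :* xb) :- v :* (xa :* xb)) refl (φ I a t) (φ I b t) (X a t) (X b t) ⟩
    φ I a t * (X a t * X b t) - φ I b t * (X a t * X b t) ∎
    where open ≡-Reasoning

  X*X-pos : 0ℚ ≤ t → 0ℚ < X a t * X b t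
  X*X-pos {t = t} {a = a} {b = b} 0≤t = positive⁻¹ (X a t * X b t)
    {{pos*pos⇒pos (X a t) {{positive (X-pos 0≤t)}} (X b t) {{positive (X-pos 0≤t)}}}}

  φ≤φ⇒0≤Δ : 0ℚ ≤ t → φ I b t ≤ φ I a t → 0ℚ ≤ Δ a b t
  φ≤φ⇒0≤Δ {t = t} {b = b} {a = a} 0≤t φb≤φa = subst (0ℚ ≤_) (sym (Δ≡[φ-φ]*X*X 0≤t))
    (x≤y⇒0≤y-x (*-monoʳ-≤-nonNeg (X a t * X b t) {{nonNegative (<⇒≤ (X*X-pos 0≤t))}} φb≤φa))

  φ≤φ⇒Δ≤0 : 0ℚ ≤ t → φ I a t ≤ φ I b t → Δ a b t ≤ 0ℚ
  φ≤φ⇒Δ≤0 {t = t} {a = a} {b = b} 0≤t φa≤φb = subst (_≤ 0ℚ) (sym (Δ≡[φ-φ]*X*X 0≤t))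
    (x≤y⇒x-y≤0 (*-monoʳ-≤-nonNeg (X a t * X b t) {{nonNegative (<⇒≤ (X*X-pos 0≤t))}} φa≤φb))

  0≤Δ⇒φ≤φ : 0ℚ ≤ t → 0ℚ ≤ Δ a b t → φ I b t ≤ φ I a t
  0≤Δ⇒φ≤φ {t = t} {a = a} {b = b} 0≤t 0≤Δ = *-cancelʳ-≤-pos (X a t * X b t) {{positive (X*X-pos 0≤t)}}
    (0≤y-x⇒x≤y (subst (0ℚ ≤_) (Δ≡[φ-φ]*X*X 0≤t) 0≤Δ))

  Δ≤0⇒φ≤φ : 0ℚ ≤ t → Δ a b t ≤ 0ℚ → φ I a t ≤ φ I b t
  Δ≤0⇒φ≤φ {t = t} {a = a} {b = b} 0≤t Δ≤0 = *-cancelʳ-≤-pos (X a t * X b t) {{positive (X*X-pos 0≤t)}}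
    (x-y≤0⇒x≤y (subst (_≤ 0ℚ) (Δ≡[φ-φ]*X*X 0≤t) Δ≤0))

  φ<φ⇒0<Δ : 0ℚ ≤ t → φ I b t < φ I a t → 0ℚ < Δ a b t
  φ<φ⇒0<Δ 0≤t φb<φa = ≰⇒> (<⇒≱ φb<φa ∘ Δ≤0⇒φ≤φ 0≤t)

  0<Δ⇒φ<φ : 0ℚ ≤ t → 0ℚ < Δ a b t → φ I b t < φ I a t
  0<Δ⇒φ<φ 0≤t 0<Δ = ≰⇒> (<⇒≱ 0<Δ ∘ φ≤φ⇒Δ≤0 0≤t)

  Δ<0⇒φ<φ : 0ℚ ≤ t → Δ a b t < 0ℚ → φ I a t < φ I b t
  Δ<0⇒φ<φ 0≤t Δ<0 = ≰⇒> (<⇒≱ Δ<0 ∘ φ≤φ⇒0≤Δ 0≤t)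

  φ≡φ⇒Δ≡0 : 0ℚ ≤ t → φ I a t ≡ φ I b t → Δ a b t ≡ 0ℚ
  φ≡φ⇒Δ≡0 0≤t φa≡φb = ≤-antisym (φ≤φ⇒Δ≤0 0≤t (≤-reflexive φa≡φb)) (φ≤φ⇒0≤Δ 0≤t (≤-reflexive (sym φa≡φb)))

  Δ≡0⇒φ≡φ : 0ℚ ≤ t → Δ a b t ≡ 0ℚ → φ I a t ≡ φ I b t
  Δ≡0⇒φ≡φ 0≤t Δ≡0 = ≤-antisym (Δ≤0⇒φ≤φ 0≤t (≤-reflexive Δ≡0)) (0≤Δ⇒φ≤φ 0≤t (≤-reflexive (sym Δ≡0)))

  slope≢0 : tstar I a b ≡ just s → slope a b ≢ 0ℚ
  slope≢0 {a = a} {b} t*≡s with w a * p b ≟ w b * p a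
  slope≢0 () | yes _
  slope≢0 _  | no wp≢wp = wp≢wp ∘ x-y≡0⇒x≡y

  Δ-root : tstar I a b ≡ just s → Δ a b s ≡ 0ℚ
  Δ-root {a = a} {b} t*≡s with w a * p b ≟ w b * p a
  Δ-root () | yes _
  Δ-root {a = a} {b} refl | no wp≢wp = begin
    slope a b * s* + intercept a b                       ≡⟨ cong (_+ intercept a b) (*-comm (slope a b) s*) ⟩
    s* * slope a b + intercept a b                       ≡⟨ cong (_+ intercept a b) (÷₀-*-cancel _ (wp≢wp ∘ x-y≡0⇒x≡y)) ⟩
    (w b * p a * p a - w a * p b * p b) + intercept a b  ≡⟨ solve 4 (λ wa pa wb pb →
        (wb :* pa :* pa :- wa :* pb :* pb) :+ (wa :* pb :* pb :- wb :* pa :* pa) := con 0ℚ)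
        refl (w a) (p a) (w b) (p b) ⟩
    0ℚ                                                   ∎
    where
    open ≡-Reasoning
    s* : ℚ
    s* = (w b * p a * p a - w a * p b * p b) ÷₀ slope a b

  tstar-defined : slope a b ≢ 0ℚ → ∃ λ s → tstar I a b ≡ just s
  tstar-defined {a = a} {b} slope≢0 with w a * p b ≟ w b * p a
  ... | yes wp≡wp = ⊥-elim (slope≢0 (trans (cong (_- w b * p a) wp≡wp) (+-inverseʳ (w b * p a))))
  ... | no _      = _ , refl

  Δ-mono-≤ : 0ℚ ≤ slope a b → t ≤ t′ → Δ a b t ≤ Δ a b t′
  Δ-mono-≤ {a = a} {b} 0≤m t≤t′ =
    +-monoˡ-≤ (intercept a b) (*-monoˡ-≤-nonNeg (slope a b) {{nonNegative 0≤m}} t≤t′)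

  Δ-mono-< : 0ℚ < slope a b → t < t′ → Δ a b t < Δ a b t′
  Δ-mono-< {a = a} {b} 0<m t<t′ =
    +-monoˡ-< (intercept a b) (*-monoʳ-<-pos (slope a b) {{positive 0<m}} t<t′)

  Δ-antimono-≤ : slope a b ≤ 0ℚ → t ≤ t′ → Δ a b t′ ≤ Δ a b t
  Δ-antimono-≤ {a = a} {b} m≤0 t≤t′ =
    +-monoˡ-≤ (intercept a b) (*-monoˡ-≤-nonPos (slope a b) {{nonPositive m≤0}} t≤t′)

  Δ-antimono-< : slope a b < 0ℚ → t < t′ → Δ a b t′ < Δ a b t
  Δ-antimono-< {a = a} {b} m<0 t<t′ =
    +-monoˡ-< (intercept a b) (*-monoʳ-<-neg (slope a b) {{negative m<0}} t<t′)

  Δ-vanishes-twice : t < t′ → Δ a b t ≡ 0ℚ → Δ a b t′ ≡ 0ℚ → ∀ u → Δ a b u ≡ 0ℚ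
  Δ-vanishes-twice {t = t} {a = a} {b = b} t<t′ Δt≡0 Δt′≡0 u with <-cmp (slope a b) 0ℚ
  ... | tri< m<0 _ _ = ⊥-elim (<-irrefl (trans Δt′≡0 (sym Δt≡0)) (Δ-antimono-< m<0 t<t′))
  ... | tri> _ _ 0<m = ⊥-elim (<-irrefl (trans Δt≡0 (sym Δt′≡0)) (Δ-mono-< 0<m t<t′))
  ... | tri≈ _ m≡0 _ = begin
    slope a b * u + intercept a b  ≡⟨ cong (_+ intercept a b) (shift u) ⟩
    slope a b * t + intercept a b  ≡⟨ Δt≡0 ⟩
    0ℚ                             ∎
    where
    open ≡-Reasoning
    shift : ∀ v → slope a b * v ≡ slope a b * t
    shift v rewrite m≡0 = trans (*-zeroˡ v) (sym (*-zeroˡ t))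

  slope-sign : tstar I a b ≡ just s → slope a b < 0ℚ ⊎ 0ℚ < slope a b
  slope-sign {a = a} {b} t*≡s with <-cmp (slope a b) 0ℚ
  ... | tri< m<0 _ _ = inj₁ m<0
  ... | tri≈ _ m≡0 _ = ⊥-elim (slope≢0 t*≡s m≡0)
  ... | tri> _ _ 0<m = inj₂ 0<m

  φ-meet-at-crossing : tstar I a b ≡ just s → 0ℚ ≤ s → φ I a s ≡ φ I b s
  φ-meet-at-crossing t*≡s 0≤s = Δ≡0⇒φ≡φ 0≤s (Δ-root t*≡s)

  φ-ahead-before-crossing : slope a b < 0ℚ → tstar I a b ≡ just s → 0ℚ ≤ t → t < s → φ I b t < φ I a t
  φ-ahead-before-crossing {a = a} {b} {t = t} m<0 t*≡s 0≤t t<s =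
    0<Δ⇒φ<φ 0≤t (subst (_< Δ a b t) (Δ-root t*≡s) (Δ-antimono-< m<0 t<s))

  φ-behind-after-crossing : slope a b < 0ℚ → tstar I a b ≡ just s → 0ℚ ≤ t → s < t → φ I a t < φ I b t
  φ-behind-after-crossing {a = a} {b} {t = t} m<0 t*≡s 0≤t s<t =
    Δ<0⇒φ<φ 0≤t (subst (Δ a b t <_) (Δ-root t*≡s) (Δ-antimono-< m<0 s<t))

  φ-weakly-behind-after-crossing : slope a b < 0ℚ → tstar I a b ≡ just s → 0ℚ ≤ t → s ≤ t → φ I a t ≤ φ I b t
  φ-weakly-behind-after-crossing {a = a} {b} {t = t} m<0 t*≡s 0≤t s≤t =
    Δ≤0⇒φ≤φ 0≤t (subst (Δ a b t ≤_) (Δ-root t*≡s) (Δ-antimono-≤ (<⇒≤ m<0) s≤t))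

  slope-neg-if-ahead-before-crossing : tstar I a b ≡ just s → 0ℚ ≤ t → t < s → φ I b t ≤ φ I a t → slope a b < 0ℚ
  slope-neg-if-ahead-before-crossing {a = a} {b} {t = t} t*≡s 0≤t t<s φb≤φa with slope-sign t*≡s
  ... | inj₁ m<0 = m<0
  ... | inj₂ 0<m = ⊥-elim (<⇒≱ (subst (Δ a b t <_) (Δ-root t*≡s) (Δ-mono-< 0<m t<s)) (φ≤φ⇒0≤Δ 0≤t φb≤φa))

  slope-neg-if-undominated : tstar I a b ≡ just s → φ I b 0ℚ < φ I a 0ℚ → ¬ Dom I a b → slope a b < 0ℚ
  slope-neg-if-undominated t*≡s φb<φa ¬dom with slope-sign t*≡s
  ... | inj₁ m<0 = m<0
  ... | inj₂ 0<m = ⊥-elim (¬dom λ t 0≤t →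
    0≤Δ⇒φ≤φ 0≤t (≤-trans (<⇒≤ (φ<φ⇒0<Δ ≤-refl φb<φa)) (Δ-mono-≤ (<⇒≤ 0<m) 0≤t)))

  φ-stays-ahead : 0ℚ ≤ slope a b → 0ℚ ≤ t → t ≤ t′ → φ I b t ≤ φ I a t → φ I b t′ ≤ φ I a t′
  φ-stays-ahead 0≤m 0≤t t≤t′ φb≤φa = 0≤Δ⇒φ≤φ (≤-trans 0≤t t≤t′) (≤-trans (φ≤φ⇒0≤Δ 0≤t φb≤φa) (Δ-mono-≤ 0≤m t≤t′))

  φ-meet-twice⇒SameФ : 0ℚ ≤ t → t < t′ → φ I a t ≡ φ I b t → φ I a t′ ≡ φ I b t′ → SameФ I a b
  φ-meet-twice⇒SameФ 0≤t t<t′ φ≡φ φ≡φ′ u 0≤u = Δ≡0⇒φ≡φ 0≤u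
    (Δ-vanishes-twice t<t′ (φ≡φ⇒Δ≡0 0≤t φ≡φ) (φ≡φ⇒Δ≡0 (≤-trans 0≤t (<⇒≤ t<t′)) φ≡φ′) u)

module Schedules {n : ℕ} (I : Instance n) where
  open Instance I

  start≤startAt : ∀ t σ x → t ≤ startAt I t σ x
  start≤startAt t []      x = ≤-refl
  start≤startAt t (y ∷ σ) x with y ≟ᶠ x
  ... | yes _ = ≤-refl
  ... | no _  = ≤-trans (<⇒≤ (x<x+y (p-pos y))) (start≤startAt (t + p y) σ x)

  before⇒finish≤start : ∀ t {σ x y} → Unique σ → Before I σ x y → startAt I t σ x + p x ≤ startAt I t σ y
  before⇒finish≤start t {x = x} {y} uniq (xs , ys , zs , refl) = go t xs uniq
    where
    go : ∀ t xs → Unique (xs ++ x ∷ ys ++ y ∷ zs) →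
         startAt I t (xs ++ x ∷ ys ++ y ∷ zs) x + p x ≤ startAt I t (xs ++ x ∷ ys ++ y ∷ zs) y
    go t [] (x∉ ∷ _) with x ≟ᶠ x | x ≟ᶠ y
    ... | no x≢x | _       = ⊥-elim (x≢x refl)
    ... | yes _  | yes x≡y = ⊥-elim (All.head (++⁻ʳ ys x∉) x≡y)
    ... | yes _  | no _    = start≤startAt (t + p x) (ys ++ y ∷ zs) y
    go t (z ∷ xs) (z∉ ∷ uniq) with z ≟ᶠ x | z ≟ᶠ y
    ... | yes z≡x | _       = ⊥-elim (All.head (++⁻ʳ xs z∉) z≡x)
    ... | no _    | yes z≡y = ⊥-elim (All.head (++⁻ʳ ys (All.tail (++⁻ʳ xs z∉))) z≡y)
    ... | no _    | no _    = go (t + p z) xs uniq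

  before⇒start< : ∀ t {σ x y} → Unique σ → Before I σ x y → startAt I t σ x < startAt I t σ y
  before⇒start< t {x = x} uniq x≺y = <-≤-trans (x<x+y (p-pos x)) (before⇒finish≤start t uniq x≺y)

  before-asym : ∀ {σ x y} → Unique σ → Before I σ x y → ¬ Before I σ y x
  before-asym uniq x≺y y≺x = <-asym (before⇒start< 0ℚ uniq x≺y) (before⇒start< 0ℚ uniq y≺x)

unique∧⊆⇒length≤∣p∣ : ∀ {n} (P : Subset n) {xs : List (Fin n)} → Unique xs → All (_∈ P) xs → length xs ℕ.≤ ∣ P ∣
unique∧⊆⇒length≤∣p∣ P {[]}     _               _            = ℕ.z≤n
unique∧⊆⇒length≤∣p∣ P {x ∷ xs} (x∉xs ∷ uniq) (x∈P ∷ xs⊆P) =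
  ℕ.≤-trans (ℕ.s≤s (unique∧⊆⇒length≤∣p∣ (P Subset.- x) uniq xs⊆P-x)) (x∈p⇒∣p-x∣<∣p∣ x∈P)
  where
  xs⊆P-x : All (_∈ P Subset.- x) xs
  xs⊆P-x = All.zipWith (λ (x≢y , y∈P) → x∈p∧x≢y⇒x∈p-y y∈P (x≢y ∘ sym)) (x∉xs , xs⊆P)

Increasing : ℕ → (ℕ → ℚ) → Set
Increasing m c = ∀ a b → 1 ℕ.≤ a → a ℕ.< b → b ℕ.≤ m → c a < c b

module _ {m : ℕ} {c : ℕ → ℚ} (c↑ : Increasing m c) where

  increasing⇒monotone : ∀ {a b} → 1 ℕ.≤ a → a ℕ.≤ b → b ℕ.≤ m → c a ≤ c b
  increasing⇒monotone {a} {b} 1≤a a≤b b≤m with ℕ.m≤n⇒m<n∨m≡n a≤b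
  ... | inj₁ a<b  = <⇒≤ (c↑ a b 1≤a a<b b≤m)
  ... | inj₂ refl = ≤-refl

  increasing⇒injective : ∀ {a b} → 1 ℕ.≤ a → 1 ℕ.≤ b → a ℕ.≤ m → b ℕ.≤ m → c a ≡ c b → a ≡ b
  increasing⇒injective {a} {b} 1≤a 1≤b a≤m b≤m ca≡cb with ℕ.<-cmp a b
  ... | tri< a<b _ _ = ⊥-elim (<-irrefl ca≡cb (c↑ a b 1≤a a<b b≤m))
  ... | tri≈ _ a≡b _ = a≡b
  ... | tri> _ _ b<a = ⊥-elim (<-irrefl (sym ca≡cb) (c↑ b a 1≤b b<a a≤m))

module PointsOfC {n : ℕ} (I : Instance n) (J' : Subset n) (to : ℚ) (α : Fin n) where
  open Instance I
  open Crossing I using (slope; φ-ahead-before-crossing; φ-behind-after-crossing; φ-meet-at-crossing)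

  Contributes : Fin n → ℚ → Set
  Contributes x v = (x ≡ α × v ≡ to) ⊎ (x ≢ α × ∃ λ s → tstar I α x ≡ just s × v ≡ s + p x)

  contributes-functional : ∀ {x v v′} → Contributes x v → Contributes x v′ → v ≡ v′
  contributes-functional (inj₁ (_ , v≡to)) (inj₁ (_ , v′≡to)) = trans v≡to (sym v′≡to)
  contributes-functional (inj₁ (x≡α , _))  (inj₂ (x≢α , _))   = ⊥-elim (x≢α x≡α)
  contributes-functional (inj₂ (x≢α , _))  (inj₁ (x≡α , _))   = ⊥-elim (x≢α x≡α)
  contributes-functional {x} (inj₂ (_ , s , t*≡s , v≡)) (inj₂ (_ , s′ , t*≡s′ , v′≡)) =
    trans v≡ (trans (cong (_+ p x) (just-injective (trans (sym t*≡s) t*≡s′))) (sym v′≡))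

  contributor : α ∈ J' → ∀ {v} → InC I J' to α v → v < tEnd I J' to → ∃ λ x → x ∈ J' × Contributes x v
  contributor α∈J' (inj₁ v≡to)        _    = α , α∈J' , inj₁ (refl , v≡to)
  contributor α∈J' (inj₂ (inj₁ v≡te)) v<te = ⊥-elim (<-irrefl v≡te v<te)
  contributor α∈J' (inj₂ (inj₂ (x , x∈J' , x≢α , s , t*≡s , v≡ , _))) _ = x , x∈J' , inj₂ (x≢α , s , t*≡s , v≡)

  -- Each c_a with a < m lies below c_m ≤ t_e, so some job of J' contributes it; distinct values have distinct contributors.
  sortedC-length : α ∈ J' → to ≤ tEnd I J' to → ∀ {m c} → IsSortedC I J' to α m c → m ℕ.≤ suc ∣ J' ∣
  sortedC-length _     _     {zero}        _          = ℕ.z≤n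
  sortedC-length α∈J' to≤te {suc r} {c} (c↑ , C⇔c) =
    ℕ.s≤s (subst (ℕ._≤ ∣ J' ∣) (length-tabulate owner)
      (unique∧⊆⇒length≤∣p∣ J' (unique-tabulate⁺ owner-injective) (all-tabulate⁺ (proj₁ ∘ proj₂ ∘ contribution))))
    where
    te : ℚ
    te = tEnd I J' to

    inC : ∀ {a} → 1 ℕ.≤ a → a ℕ.≤ suc r → InC I J' to α (c a)
    inC 1≤a a≤m = Equivalence.from (C⇔c (c _)) (_ , 1≤a , a≤m , refl)

    cₘ≤te : c (suc r) ≤ te
    cₘ≤te with inC (ℕ.s≤s ℕ.z≤n) ℕ.≤-refl
    ... | inj₁ cₘ≡to                                      = subst (_≤ te) (sym cₘ≡to) to≤te
    ... | inj₂ (inj₁ cₘ≡te)                               = ≤-reflexive cₘ≡te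
    ... | inj₂ (inj₂ (_ , _ , _ , _ , _ , _ , _ , cₘ<te)) = <⇒≤ cₘ<te

    index≤m : (i : Fin r) → suc (toℕ i) ℕ.≤ suc r
    index≤m i = ℕ.m≤n⇒m≤1+n (toℕ<n i)

    contribution : (i : Fin r) → ∃ λ x → x ∈ J' × Contributes x (c (suc (toℕ i)))
    contribution i = contributor α∈J' (inC (ℕ.s≤s ℕ.z≤n) (index≤m i))
      (<-≤-trans (c↑ _ _ (ℕ.s≤s ℕ.z≤n) (ℕ.s≤s (toℕ<n i)) ℕ.≤-refl) cₘ≤te)

    owner : Fin r → Fin n
    owner = proj₁ ∘ contribution

    owner-injective : ∀ {i i′} → owner i ≡ owner i′ → i ≡ i′
    owner-injective {i} {i′} same-owner = toℕ-injective (ℕ.suc-injective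
      (increasing⇒injective c↑ (ℕ.s≤s ℕ.z≤n) (ℕ.s≤s ℕ.z≤n) (index≤m i) (index≤m i′)
        (contributes-functional (proj₂ (proj₂ (contribution i)))
          (subst (λ x → Contributes x _) (sym same-owner) (proj₂ (proj₂ (contribution i′)))))))

  module _ {m : ℕ} {c : ℕ → ℚ} (sorted : IsSortedC I J' to α m c) where

    M≤q⇒early-crossing : m ℕ.≤ suc ∣ J' ∣ → ∀ {j qj q} → j ≢ α → MIs I J' to α m c j qj → qj ℕ.≤ q → q ℕ.< m →
                         ∃ λ s → tstar I α j ≡ just s × to < s × s + p j ≤ c q
    M≤q⇒early-crossing _ j≢α (inj₁ (j≡α , _)) _ _ = ⊥-elim (j≢α j≡α)
    M≤q⇒early-crossing m≤ _ (inj₂ (inj₂ (_ , _ , refl))) qj≤q q<m =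
      ⊥-elim (ℕ.<-irrefl refl (ℕ.<-≤-trans (ℕ.≤-<-trans qj≤q q<m) m≤))
    M≤q⇒early-crossing _ _ (inj₂ (inj₁ (_ , s , (t*≡s , to<s , _) , 1≤qj , _ , c≡s+p))) qj≤q q<m =
      s , t*≡s , to<s , subst (_≤ _) c≡s+p (increasing⇒monotone (proj₁ sorted) 1≤qj qj≤q (ℕ.<⇒≤ q<m))

    M>q⇒late-crossing : ∀ {k qk q s} → k ≢ α → MIs I J' to α m c k qk → q ℕ.< qk →
                        tstar I α k ≡ just s → to < s → s + p k < tEnd I J' to → c (suc q) ≤ s + p k
    M>q⇒late-crossing k≢α (inj₁ (k≡α , _)) _ _ _ _ = ⊥-elim (k≢α k≡α)
    M>q⇒late-crossing {k} {s = s} _ (inj₂ (inj₂ (_ , ¬cond , _))) _ t*≡s to<s s+p<te =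
      ⊥-elim (¬cond (s , t*≡s , to<s , <-trans (x<x+y (p-pos k)) s+p<te , s+p<te))
    M>q⇒late-crossing {k} _ (inj₂ (inj₁ (_ , s′ , (t*≡s′ , _) , _ , qk≤m , c≡s′+p))) q<qk t*≡s _ _ =
      ≤-trans (increasing⇒monotone (proj₁ sorted) (ℕ.s≤s ℕ.z≤n) q<qk qk≤m)
              (≤-reflexive (trans c≡s′+p (cong (_+ p k) (just-injective (trans (sym t*≡s′) t*≡s)))))

    -- Otherwise t_α would lie in [t*_{αk}, t*_{αk} + p_k), a piece of B_α.
    M>q⇒crossing-after-tα : ∀ {k qk q tα s} → 0ℚ ≤ to → to ≤ tα → tα < tEnd I J' to → tEnd I J' to ≤ T I →
      tα < c (suc q) → ¬ InB I α tα → k ≢ α → MIs I J' to α m c k qk → q ℕ.< qk →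
      φ I k to ≤ φ I α to → (φ I k to ≡ φ I α to → φ I k (tEnd I J' to) ≤ φ I α (tEnd I J' to)) →
      tstar I α k ≡ just s → slope α k < 0ℚ → tα < s
    M>q⇒crossing-after-tα {k} {tα = tα} {s} 0≤to to≤tα tα<te te≤T tα<cq+1 tα∉B k≢α Mk q<qk k-behind k-tie t*≡s m<0 =
      ≰⇒> (tα∉B ∘ tα∈B)
      where
      te : ℚ
      te = tEnd I J' to

      to<te : to < te
      to<te = ≤-<-trans to≤tα tα<te

      to<s : to < s
      to<s with <-cmp to s
      ... | tri< to<s _ _ = to<s
      ... | tri≈ _ to≡s _ = contradiction (k-tie meet-at-to)
                              (<⇒≱ (φ-behind-after-crossing m<0 t*≡s (<⇒≤ (≤-<-trans 0≤to to<te)) (subst (_< te) to≡s to<te)))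
        where
        meet-at-to : φ I k to ≡ φ I α to
        meet-at-to = subst (λ t → φ I k t ≡ φ I α t) (sym to≡s) (sym (φ-meet-at-crossing t*≡s (subst (0ℚ ≤_) to≡s 0≤to)))
      ... | tri> _ _ s<to = contradiction k-behind (<⇒≱ (φ-behind-after-crossing m<0 t*≡s 0≤to s<to))

      0<s : 0ℚ < s
      0<s = ≤-<-trans 0≤to to<s

      tα<s+p : tα < s + p k
      tα<s+p with s + p k <? te
      ... | yes s+p<te = <-≤-trans tα<cq+1 (M>q⇒late-crossing k≢α Mk q<qk t*≡s to<s s+p<te)
      ... | no s+p≮te  = <-≤-trans tα<te (≮⇒≥ s+p≮te)

      tα∈B : s ≤ tα → InB I α tα
      tα∈B s≤tα = k , k≢α , φ-ahead-before-crossing m<0 t*≡s ≤-refl 0<s , s , t*≡s , 0<s ,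
                  ≤-<-trans s≤tα (<-≤-trans tα<te te≤T) , s≤tα , tα<s+p

module PairsAroundα {n : ℕ} (I : Instance n) {to te tα sⱼ : ℚ} {α j k : Fin n} {σ : List (Fin n)}
  (0≤to : 0ℚ ≤ to) (to≤tα : to ≤ tα) (to<te : to < te)
  (j-behind : φ I j to ≤ φ I α to) (k-behind : φ I k to ≤ φ I α to)
  (k-tie : φ I k to ≡ φ I α to → φ I k te ≤ φ I α te)
  (t*≡sⱼ : tstar I α j ≡ just sⱼ) (to<sⱼ : to < sⱼ) (sⱼ+pⱼ≤tα : sⱼ + Instance.p I j ≤ tα)
  (k-crosses-late : ∀ {s} → tstar I α k ≡ just s → Crossing.slope I α k < 0ℚ → tα < s)
  (uniq : Unique σ) (start-α : startAt I to σ α ≡ tα) (j≺α : Before I σ j α) (α≺k : Before I σ α k)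
  where
  open Instance I
  open Crossing I
  open Schedules I

  tₖ : ℚ
  tₖ = startAt I to σ k

  uⱼ : ℚ
  uⱼ = tα - p j

  0≤tα : 0ℚ ≤ tα
  0≤tα = ≤-trans 0≤to to≤tα

  sⱼ≤uⱼ : sⱼ ≤ uⱼ
  sⱼ≤uⱼ = x+z≤y⇒x≤y-z sⱼ+pⱼ≤tα

  to≤uⱼ : to ≤ uⱼ
  to≤uⱼ = ≤-trans (<⇒≤ to<sⱼ) sⱼ≤uⱼ

  0≤uⱼ : 0ℚ ≤ uⱼ
  0≤uⱼ = ≤-trans 0≤to to≤uⱼ

  uⱼ≤tα : uⱼ ≤ tα
  uⱼ≤tα = subst (uⱼ ≤_) (+-identityʳ tα) (+-monoʳ-≤ tα (neg-antimono-≤ (<⇒≤ (p-pos j))))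

  slope-αj<0 : slope α j < 0ℚ
  slope-αj<0 = slope-neg-if-ahead-before-crossing t*≡sⱼ 0≤to to<sⱼ j-behind

  φj<φα-at-0 : φ I j 0ℚ < φ I α 0ℚ
  φj<φα-at-0 = φ-ahead-before-crossing slope-αj<0 t*≡sⱼ ≤-refl (≤-<-trans 0≤to to<sⱼ)

  φα<φj-at-tα : φ I α tα < φ I j tα
  φα<φj-at-tα = φ-behind-after-crossing slope-αj<0 t*≡sⱼ 0≤tα (<-≤-trans (x<x+y (p-pos j)) sⱼ+pⱼ≤tα)

  φα≤φj-at-uⱼ : φ I α uⱼ ≤ φ I j uⱼ
  φα≤φj-at-uⱼ = φ-weakly-behind-after-crossing slope-αj<0 t*≡sⱼ 0≤uⱼ sⱼ≤uⱼ

  k-behind-until-tα : ∀ {t} → to ≤ t → t ≤ tα → φ I k t ≤ φ I α t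
  k-behind-until-tα {t} to≤t t≤tα with 0ℚ ≤? slope α k
  ... | yes 0≤m = φ-stays-ahead 0≤m 0≤to to≤t k-behind
  ... | no 0≰m with tstar-defined (<⇒≢ (≰⇒> 0≰m))
  ...   | s , t*≡s = <⇒≤ (φ-ahead-before-crossing (≰⇒> 0≰m) t*≡s (≤-trans 0≤to to≤t)
                            (≤-<-trans t≤tα (k-crosses-late t*≡s (≰⇒> 0≰m))))

  φk<φj-at-tα : φ I k tα < φ I j tα
  φk<φj-at-tα = ≤-<-trans (k-behind-until-tα to≤tα ≤-refl) φα<φj-at-tα

  φk≤φj-at-uⱼ : φ I k uⱼ ≤ φ I j uⱼ
  φk≤φj-at-uⱼ = ≤-trans (k-behind-until-tα to≤uⱼ uⱼ≤tα) φα≤φj-at-uⱼ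

  tⱼ<tα : startAt I to σ j < tα
  tⱼ<tα = subst (startAt I to σ j <_) start-α (before⇒start< to uniq j≺α)

  tα+pα≤tₖ : tα + p α ≤ tₖ
  tα+pα≤tₖ = subst (λ t → t + p α ≤ tₖ) start-α (before⇒finish≤start to uniq α≺k)

  tα≤tₖ : tα ≤ tₖ
  tα≤tₖ = ≤-trans (<⇒≤ (x<x+y (p-pos α))) tα+pα≤tₖ

  k⊀j : ¬ Before I σ k j
  k⊀j k≺j = <-asym (before⇒start< to uniq k≺j) (<-trans (before⇒start< to uniq j≺α) (before⇒start< to uniq α≺k))

  αj-respected : ¬ PairViolated I to σ α j
  αj-respected (inj₁ (inj₁ (α≽j , _ , _))) = <⇒≱ φα<φj-at-tα (α≽j tα 0≤tα)
  αj-respected (inj₁ (inj₂ (_ , _ , _ , s , t*≡s , inj₁ (_ , tα-pⱼ<s)))) =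
    <⇒≱ (subst (λ t → t - p j < s) start-α tα-pⱼ<s) (subst (_≤ uⱼ) (just-injective (trans (sym t*≡sⱼ) t*≡s)) sⱼ≤uⱼ)
  αj-respected (inj₁ (inj₂ (_ , _ , _ , _ , _ , inj₂ (α≺j , _)))) = before-asym uniq j≺α α≺j
  αj-respected (inj₂ (inj₁ (j≽α , _ , _))) = <⇒≱ φj<φα-at-0 (j≽α 0ℚ ≤-refl)
  αj-respected (inj₂ (inj₂ (_ , _ , φα<φj , _))) = <-asym φα<φj φj<φα-at-0

  αk-respected : ¬ PairViolated I to σ α k
  αk-respected (inj₁ (inj₁ (_ , _ , k≺α))) = before-asym uniq α≺k k≺α
  αk-respected (inj₁ (inj₂ (_ , _ , _ , _ , _ , inj₁ (k≺α , _)))) = before-asym uniq α≺k k≺α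
  αk-respected (inj₁ (inj₂ (α⋡k , _ , φk<φα , s , t*≡s , inj₂ (_ , s≤tα)))) =
    <⇒≱ (k-crosses-late t*≡s (slope-neg-if-undominated t*≡s φk<φα α⋡k)) (subst (s ≤_) start-α s≤tα)
  αk-respected (inj₂ (inj₁ (k≽α , ¬same , _))) =
    ¬same (φ-meet-twice⇒SameФ 0≤to to<te meet-at-to (≤-antisym (k-tie meet-at-to) (k≽α te 0≤te)))
    where
    0≤te : 0ℚ ≤ te
    0≤te = <⇒≤ (≤-<-trans 0≤to to<te)
    meet-at-to : φ I k to ≡ φ I α to
    meet-at-to = ≤-antisym k-behind (k≽α to 0≤to)
  αk-respected (inj₂ (inj₂ (k⋡α , _ , φα<φk , s , t*≡s , inj₁ (_ , tₖ-pα<s)))) =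
    <⇒≱ tₖ-pα<s (≤-trans s≤to (≤-trans to≤tα (x+z≤y⇒x≤y-z tα+pα≤tₖ)))
    where
    s≤to : s ≤ to
    s≤to = ≮⇒≥ λ to<s → <⇒≱ (φ-ahead-before-crossing (slope-neg-if-undominated t*≡s φα<φk k⋡α) t*≡s 0≤to to<s) k-behind
  αk-respected (inj₂ (inj₂ (_ , _ , _ , _ , _ , inj₂ (k≺α , _)))) = before-asym uniq α≺k k≺α

  jk-respected : ¬ PairViolated I to σ j k
  jk-respected (inj₁ (inj₁ (_ , _ , k≺j))) = k⊀j k≺j
  jk-respected (inj₁ (inj₂ (_ , _ , _ , _ , _ , inj₁ (k≺j , _)))) = k⊀j k≺j
  jk-respected (inj₁ (inj₂ (j⋡k , _ , φk<φj , s , t*≡s , inj₂ (_ , s≤tⱼ)))) =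
    <-irrefl refl (≤-<-trans s≤tⱼ (<-trans tⱼ<tα tα<s))
    where
    tα<s : tα < s
    tα<s = ≰⇒> λ s≤tα → <⇒≱ φk<φj-at-tα
      (φ-weakly-behind-after-crossing (slope-neg-if-undominated t*≡s φk<φj j⋡k) t*≡s 0≤tα s≤tα)
  jk-respected (inj₂ (inj₁ (k≽j , _ , _))) = <⇒≱ φk<φj-at-tα (k≽j tα 0≤tα)
  jk-respected (inj₂ (inj₂ (k⋡j , _ , φj<φk , s , t*≡s , inj₁ (_ , tₖ-pⱼ<s)))) =
    <⇒≱ tₖ-pⱼ<s (≤-trans s≤uⱼ (+-monoˡ-≤ (- p j) tα≤tₖ))
    where
    s≤uⱼ : s ≤ uⱼ
    s≤uⱼ = ≮⇒≥ λ uⱼ<s → <⇒≱ (φ-ahead-before-crossing (slope-neg-if-undominated t*≡s φj<φk k⋡j) t*≡s 0≤uⱼ uⱼ<s) φk≤φj-at-uⱼ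
  jk-respected (inj₂ (inj₂ (_ , _ , _ , _ , _ , inj₂ (k≺j , _)))) = k⊀j k≺j

lemma7 : ∀ {n} (I : Instance n) (J' : Subset n) (to : ℚ) (α : Fin n)
    (m : ℕ) (c : ℕ → ℚ) (q : ℕ) (tα : ℚ) (j k : Fin n) (σ : List (Fin n)) →
    0ℚ ≤ to → to ≤ T I - sumP I J' →
    IsAlpha I J' to α →
    IsSortedC I J' to α m c →
    1 Data.Nat.≤ q → suc q Data.Nat.≤ m →
    c q ≤ tα → tα < c (suc q) →
    to ≤ tα → tα ≤ tEnd I J' to - Instance.p I α →
    ¬ InB I α tα →
    j ∈ J' → j ≢ α → k ∈ J' → k ≢ α →
    (∃ λ qj → MIs I J' to α m c j qj × qj Data.Nat.≤ q) →
    (∃ λ qk → MIs I J' to α m c k qk × q Data.Nat.< qk) →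
    IsScheduleOf I J' σ →
    startAt I to σ α ≡ tα →
    Before I σ j α → Before I σ α k →
    ¬ PairViolated I to σ α j × ¬ PairViolated I to σ α k × ¬ PairViolated I to σ j k
lemma7 I J' to α m c q tα j k σ 0≤to to≤T-ΣJ' (α∈J' , α-max , α-tie) sorted _ q<m cq≤tα tα<cq+1 to≤tα tα≤te-pα
       tα∉B j∈J' j≢α k∈J' k≢α (_ , Mj , qj≤q) (_ , Mk , q<qk) (uniq , _) start-α j≺α α≺k =
  let _ , t*≡sⱼ , to<sⱼ , sⱼ+pⱼ≤cq = M≤q⇒early-crossing sorted (sortedC-length α∈J' to≤te sorted) j≢α Mj qj≤q q<m
      open PairsAroundα I 0≤to to≤tα (≤-<-trans to≤tα tα<te) (α-max j j∈J') (α-max k k∈J') (α-tie k k∈J')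
             t*≡sⱼ to<sⱼ (≤-trans sⱼ+pⱼ≤cq cq≤tα)
             (M>q⇒crossing-after-tα sorted 0≤to to≤tα tα<te (x≤y-z⇒x+z≤y to≤T-ΣJ') tα<cq+1 tα∉B k≢α Mk q<qk
               (α-max k k∈J') (α-tie k k∈J'))
             uniq start-α j≺α α≺k
  in αj-respected , αk-respected , jk-respected
  where
  open PointsOfC I J' to α

  tα<te : tα < tEnd I J' to
  tα<te = <-≤-trans (x<x+y (Instance.p-pos I α)) (x≤y-z⇒x+z≤y tα≤te-pα)

  to≤te : to ≤ tEnd I J' to
  to≤te = ≤-trans to≤tα (<⇒≤ tα<te)
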